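{- Let $B$ be a block of a connected graph $G$. (a) If $B$ contains more than two cut-vertices of $G$, then $G$ is not traceable. (b) If $G$ is maximal nontraceable, then $B$ contains at most three cut-vertices of $G$. (c) If $G$ is maximal nontraceable and $B$ contains exactly three cut-vertices of $G$, then $G$ consists of exactly four blocks, each of which is complete.
   Context: Graphs are simple and finite. A block is a maximal connected subgraph without a cut-vertex of itself. A graph is traceable if it has a hamiltonian path. A graph $G$ is maximal nontraceable if $G$ is not traceable but $G+e$ is traceable for every pair of nonadjacent vertices joined by a new edge $e$. -}

module Defs where

open import Data.Nat using (ℕ)
open import Data.Fin using (Fin; _≟_)
open import Data.Bool using (Bool; true; false; _∧_; _∨_; not)
open import Data.Product using (Σ; ∃; _×_; _,_)
open import Data.List using (List)
open import Data.List.Relation.Unary.Unique.Propositional using (Unique)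
open import Data.List.Relation.Unary.Linked using (Linked)
open import Data.List.Membership.Propositional using (_∈_)
open import Relation.Nullary using (¬_; does)
open import Relation.Binary.PropositionalEquality using (_≡_; _≢_)

record Graph (n : ℕ) : Set where
  field
    adj    : Fin n → Fin n → Bool
    sym    : ∀ x y → adj x y ≡ adj y x
    irrefl : ∀ x → adj x x ≡ false
open Graph public

record Subgraph {n : ℕ} (G : Graph n) : Set where
  field
    V     : Fin n → Bool
    E     : Fin n → Fin n → Bool
    E-sym : ∀ x y → E x y ≡ E y x
    E-adj : ∀ x y → E x y ≡ true → adj G x y ≡ true
    E-V   : ∀ x y → E x y ≡ true → V x ≡ true
open Subgraph public

whole : ∀ {n} (G : Graph n) → Subgraph G
whole G = record
  { V = λ _ → true ; E = adj G ; E-sym = sym G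
  ; E-adj = λ _ _ p → p ; E-V = λ _ _ _ → _≡_.refl }

data Reach {n : ℕ} (V : Fin n → Bool) (E : Fin n → Fin n → Bool)
     : Fin n → Fin n → Set where
  here : ∀ {x} → V x ≡ true → Reach V E x x
  step : ∀ {x y z} → E x y ≡ true → Reach V E y z → Reach V E x z

ConnectedVE : ∀ {n} → (Fin n → Bool) → (Fin n → Fin n → Bool) → Set
ConnectedVE {n} V E =
  (∃ λ (x : Fin n) → V x ≡ true) ×
  (∀ x y → V x ≡ true → V y ≡ true → Reach V E x y)

Connected : ∀ {n} {G : Graph n} → Subgraph G → Set
Connected H = ConnectedVE (V H) (E H)

delV : ∀ {n} → (Fin n → Bool) → Fin n → (Fin n → Bool)
delV V v x = V x ∧ not (does (x ≟ v))

delE : ∀ {n} → (Fin n → Fin n → Bool) → Fin n → (Fin n → Fin n → Bool)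
delE E v x y = E x y ∧ not (does (x ≟ v)) ∧ not (does (y ≟ v))

IsCutVertex : ∀ {n} {G : Graph n} → Subgraph G → Fin n → Set
IsCutVertex {n} H v =
  V H v ≡ true ×
  (∃ λ (x : Fin n) → ∃ λ (y : Fin n) →
     delV (V H) v x ≡ true × delV (V H) v y ≡ true ×
     ¬ Reach (delV (V H) v) (delE (E H) v) x y)

CutVertex : ∀ {n} → Graph n → Fin n → Set
CutVertex G v = IsCutVertex (whole G) v

Nonseparable : ∀ {n} {G : Graph n} → Subgraph G → Set
Nonseparable {n} H = Connected H × (∀ (v : Fin n) → ¬ IsCutVertex H v)

_⊆S_ : ∀ {n} {G : Graph n} → Subgraph G → Subgraph G → Set
H ⊆S K = (∀ x → V H x ≡ true → V K x ≡ true) ×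
         (∀ x y → E H x y ≡ true → E K x y ≡ true)

_≈S_ : ∀ {n} {G : Graph n} → Subgraph G → Subgraph G → Set
H ≈S K = H ⊆S K × K ⊆S H

IsBlock : ∀ {n} (G : Graph n) → Subgraph G → Set
IsBlock G B = Nonseparable B ×
  (∀ (K : Subgraph G) → Nonseparable K → B ⊆S K → K ⊆S B)

CompleteS : ∀ {n} {G : Graph n} → Subgraph G → Set
CompleteS H = ∀ x y → V H x ≡ true → V H y ≡ true → x ≢ y → E H x y ≡ true

record HamPath {n : ℕ} (a : Fin n → Fin n → Bool) : Set where
  field
    path   : List (Fin n)
    unique : Unique path
    covers : ∀ v → v ∈ path
    linked : Linked (λ x y → a x y ≡ true) path

TraceableAdj : ∀ {n} → (Fin n → Fin n → Bool) → Set
TraceableAdj a = HamPath a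

Traceable : ∀ {n} → Graph n → Set
Traceable G = TraceableAdj (adj G)

addEdge : ∀ {n} → (Fin n → Fin n → Bool) → Fin n → Fin n → (Fin n → Fin n → Bool)
addEdge a u v x y =
  a x y ∨ ((does (x ≟ u) ∧ does (y ≟ v)) ∨ (does (x ≟ v) ∧ does (y ≟ u)))

MaximalNontraceable : ∀ {n} → Graph n → Set
MaximalNontraceable {n} G =
  ¬ Traceable G ×
  (∀ (u v : Fin n) → u ≢ v → adj G u v ≡ false → TraceableAdj (addEdge (adj G) u v))

CutIn : ∀ {n} (G : Graph n) → Subgraph G → Fin n → Set
CutIn G B v = V B v ≡ true × CutVertex G v

MoreThanTwoCuts : ∀ {n} (G : Graph n) → Subgraph G → Set
MoreThanTwoCuts {n} G B = Σ (Fin n) λ a → Σ (Fin n) λ b → Σ (Fin n) λ c →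
  CutIn G B a × CutIn G B b × CutIn G B c × a ≢ b × a ≢ c × b ≢ c

AtMostThreeCuts : ∀ {n} (G : Graph n) → Subgraph G → Set
AtMostThreeCuts {n} G B = ¬ (Σ (Fin n) λ a → Σ (Fin n) λ b → Σ (Fin n) λ c → Σ (Fin n) λ d →
  CutIn G B a × CutIn G B b × CutIn G B c × CutIn G B d ×
  a ≢ b × a ≢ c × a ≢ d × b ≢ c × b ≢ d × c ≢ d)

ExactlyThreeCuts : ∀ {n} (G : Graph n) → Subgraph G → Set
ExactlyThreeCuts {n} G B = Σ (Fin n) λ a → Σ (Fin n) λ b → Σ (Fin n) λ c →
  CutIn G B a × CutIn G B b × CutIn G B c × a ≢ b × a ≢ c × b ≢ c ×
  (∀ w → CutIn G B w → (w ≡ a ⊎ w ≡ b ⊎ w ≡ c))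
  where open import Data.Sum using (_⊎_)

FourCompleteBlocks : ∀ {n} (G : Graph n) → Set
FourCompleteBlocks G =
  Σ (Subgraph G) λ B₁ → Σ (Subgraph G) λ B₂ → Σ (Subgraph G) λ B₃ → Σ (Subgraph G) λ B₄ →
  IsBlock G B₁ × IsBlock G B₂ × IsBlock G B₃ × IsBlock G B₄ ×
  ¬ (B₁ ≈S B₂) × ¬ (B₁ ≈S B₃) × ¬ (B₁ ≈S B₄) × ¬ (B₂ ≈S B₃) × ¬ (B₂ ≈S B₄) × ¬ (B₃ ≈S B₄) ×
  (∀ B → IsBlock G B → B ≈S B₁ ⊎ B ≈S B₂ ⊎ B ≈S B₃ ⊎ B ≈S B₄) ×
  CompleteS B₁ × CompleteS B₂ × CompleteS B₃ × CompleteS B₄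
  where open import Data.Sum using (_⊎_)

{-# OPTIONS --safe #-}
module Submission where

-- For a vertex v of B, let Branch v be the set of vertices that G − v separates from B − v.
-- Every edge leaving Branch v ends at v, so a Hamiltonian path meeting Branch v but starting
-- and ending outside it would pass through v twice: each nonempty branch contains an end of
-- the path. Branches at distinct vertices of B are disjoint because G is connected, and the
-- branch at a cut-vertex of G in B is nonempty because B has no cut-vertex. Three of them
-- would need three ends, which gives (a).
-- In a maximal nontraceable graph, two vertices u ≠ w are adjacent as soon as every edge of
-- G + uw leaving one of three such branches still ends at its vertex, because G + uw is then
-- nontraceable by the same argument. For (b), this makes a vertex of the branch at a adjacent
-- to a second cut-vertex b (using the branches at b, c, d), an edge that leaves the branch at
-- a through b ≠ a. For (c), the forced edges make B and each {v} ∪ Branch v complete; a vertex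
-- outside B and the three branches would be adjacent to all of B and could be added to B, so
-- these four complete graphs are exactly the blocks of G.

open import Defs
open import Level using (0ℓ)
open import Data.Nat using (ℕ)
open import Data.Fin using (Fin; _≟_)
open import Data.Fin.Properties using (any?)
open import Data.Bool using (Bool; true; false; _∧_; _∨_; not)
import Data.Bool as Bool
open import Data.Bool.Properties using (∧-comm; ∨-comm; ∧-conicalˡ; ∧-conicalʳ; ∨-zeroʳ; ¬-not)
open import Data.Product using (∃; _×_; _,_; proj₁; proj₂)
open import Data.Sum using (_⊎_; inj₁; inj₂; [_,_])
import Data.Sum as Sum
open import Data.Empty using (⊥; ⊥-elim)
open import Data.List using (List; []; _∷_)
open import Data.List.Relation.Unary.Any using (Any; here; there)
import Data.List.Relation.Unary.Any as Any
import Data.List.Relation.Unary.All as All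
open import Data.List.Relation.Unary.AllPairs using (_∷_)
open import Data.List.Relation.Unary.Linked using (Linked; _∷_)
open import Data.List.Relation.Unary.Unique.Propositional using (Unique)
open import Data.List.Membership.Propositional using (_∈_; lose)
open import Function using (_∘_; case_of_)
open import Relation.Nullary using (¬_; does; yes; no; Dec; _×-dec_)
open import Relation.Nullary.Decidable using (dec-true; dec-false; decidable-stable; ¬¬-excluded-middle)
open import Relation.Nullary.Negation using (¬¬-map; contradiction)
open import Relation.Unary using (Pred; Satisfiable; Empty; _∩_)
open import Relation.Binary.PropositionalEquality using (_≡_; _≢_; refl; trans; cong; cong₂)
import Relation.Binary.PropositionalEquality as ≡

∧-true : ∀ {x y} → x ≡ true → y ≡ true → x ∧ y ≡ true
∧-true refl refl = refl

∨-true⁻ : ∀ {x y} → x ∨ y ≡ true → x ≡ true ⊎ y ≡ true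
∨-true⁻ {true}  _ = inj₁ refl
∨-true⁻ {false} p = inj₂ p

∨-trueˡ : ∀ {x y} → x ≡ true → x ∨ y ≡ true
∨-trueˡ refl = refl

∨-trueʳ : ∀ {x y} → y ≡ true → x ∨ y ≡ true
∨-trueʳ {x} refl = ∨-zeroʳ x

≡true⇒≢false : ∀ {x} → x ≡ true → x ≢ false
≡true⇒≢false refl ()

not-true⁻ : ∀ {x} → not x ≡ true → x ≡ false
not-true⁻ {false} _ = refl

not-true⁺ : ∀ {x} → ¬ x ≡ true → not x ≡ true
not-true⁺ {false} _ = refl
not-true⁺ {true}  p = contradiction refl p

module _ {n : ℕ} where

  ≟-true⁻ : {x y : Fin n} → does (x ≟ y) ≡ true → x ≡ y
  ≟-true⁻ {x} {y} p with x ≟ y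
  ... | yes x≡y = x≡y

  not-≟-true⁻ : {x y : Fin n} → not (does (x ≟ y)) ≡ true → x ≢ y
  not-≟-true⁻ {x} {y} p x≡y with x ≟ y
  ... | no x≢y = x≢y x≡y

  not-≟-true⁺ : {x y : Fin n} → x ≢ y → not (does (x ≟ y)) ≡ true
  not-≟-true⁺ {x} {y} x≢y = cong not (dec-false (x ≟ y) x≢y)

  delV-true⁻ : ∀ (V : Fin n → Bool) {v x} → delV V v x ≡ true → V x ≡ true × x ≢ v
  delV-true⁻ V {x = x} p = ∧-conicalˡ (V x) _ p , not-≟-true⁻ (∧-conicalʳ (V x) _ p)

  delV-true⁺ : ∀ (V : Fin n → Bool) {v x} → V x ≡ true → x ≢ v → delV V v x ≡ true
  delV-true⁺ V Vx x≢v = ∧-true Vx (not-≟-true⁺ x≢v)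

  delE-true⁻ : ∀ (E : Fin n → Fin n → Bool) {v x y} → delE E v x y ≡ true →
               E x y ≡ true × x ≢ v × y ≢ v
  delE-true⁻ E {x = x} {y} p =
    ∧-conicalˡ (E x y) _ p ,
    not-≟-true⁻ (∧-conicalˡ _ _ (∧-conicalʳ (E x y) _ p)) ,
    not-≟-true⁻ (∧-conicalʳ _ _ (∧-conicalʳ (E x y) _ p))

  delE-true⁺ : ∀ (E : Fin n → Fin n → Bool) {v x y} → E x y ≡ true → x ≢ v → y ≢ v →
               delE E v x y ≡ true
  delE-true⁺ E Exy x≢v y≢v = ∧-true Exy (∧-true (not-≟-true⁺ x≢v) (not-≟-true⁺ y≢v))

  addEdge-sym : ∀ (a : Fin n → Fin n → Bool) → (∀ x y → a x y ≡ a y x) →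
                ∀ u w x y → addEdge a u w x y ≡ addEdge a u w y x
  addEdge-sym a a-sym u w x y = cong₂ _∨_ (a-sym x y) (begin
      (does (x ≟ u) ∧ does (y ≟ w)) ∨ (does (x ≟ w) ∧ does (y ≟ u))
    ≡⟨ cong₂ _∨_ (∧-comm (does (x ≟ u)) _) (∧-comm (does (x ≟ w)) _) ⟩
      (does (y ≟ w) ∧ does (x ≟ u)) ∨ (does (y ≟ u) ∧ does (x ≟ w))
    ≡⟨ ∨-comm (does (y ≟ w) ∧ _) _ ⟩
      (does (y ≟ u) ∧ does (x ≟ w)) ∨ (does (y ≟ w) ∧ does (x ≟ u))
    ∎)
    where open ≡.≡-Reasoning

  addEdge-true⁻ : ∀ {a : Fin n → Fin n → Bool} {u w x y} → addEdge a u w x y ≡ true →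
                  a x y ≡ true ⊎ (x ≡ u × y ≡ w) ⊎ (x ≡ w × y ≡ u)
  addEdge-true⁻ {a} {u} {w} {x} {y} p with ∨-true⁻ {a x y} p
  ... | inj₁ axy = inj₁ axy
  ... | inj₂ q with ∨-true⁻ {does (x ≟ u) ∧ does (y ≟ w)} q
  ...   | inj₁ r = inj₂ (inj₁ (≟-true⁻ (∧-conicalˡ _ _ r) , ≟-true⁻ (∧-conicalʳ _ _ r)))
  ...   | inj₂ r = inj₂ (inj₂ (≟-true⁻ (∧-conicalˡ _ _ r) , ≟-true⁻ (∧-conicalʳ _ _ r)))

module _ {n : ℕ} {V : Fin n → Bool} {E : Fin n → Fin n → Bool} where

  Reach-trans : ∀ {x y z} → Reach V E x y → Reach V E y z → Reach V E x z
  Reach-trans (here _)    q = q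
  Reach-trans (step xy p) q = step xy (Reach-trans p q)

  Reach-target : ∀ {x y} → Reach V E x y → V y ≡ true
  Reach-target (here Vx)  = Vx
  Reach-target (step _ p) = Reach-target p

  Reach-sym : (∀ x y → E x y ≡ true → E y x ≡ true) → (∀ x y → E x y ≡ true → V x ≡ true) →
              ∀ {x y} → Reach V E x y → Reach V E y x
  Reach-sym symmetric source (here Vx)            = here Vx
  Reach-sym symmetric source (step {x} {y} xy p) =
    Reach-trans (Reach-sym symmetric source p) (step (symmetric x y xy) (here (source x y xy)))

Reach-mono : ∀ {n} {V V′ : Fin n → Bool} {E E′ : Fin n → Fin n → Bool} →
             (∀ x → V x ≡ true → V′ x ≡ true) → (∀ x y → E x y ≡ true → E′ x y ≡ true) →
             ∀ {x y} → Reach V E x y → Reach V′ E′ x y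
Reach-mono V⊆V′ E⊆E′ (here Vx)   = here (V⊆V′ _ Vx)
Reach-mono V⊆V′ E⊆E′ (step xy p) = step (E⊆E′ _ _ xy) (Reach-mono V⊆V′ E⊆E′ p)

last⁺ : ∀ {A : Set} → A → List A → A
last⁺ x []       = x
last⁺ _ (y ∷ ys) = last⁺ y ys

module _ {n : ℕ} (ad : Fin n → Fin n → Bool) where

  ExitsOnlyVia : Pred (Fin n) 0ℓ → Fin n → Set
  ExitsOnlyVia C v = ∀ {x y} → ad x y ≡ true → C x → ¬ C y → y ≡ v

  private
    Adjacent : Fin n → Fin n → Set
    Adjacent x y = ad x y ≡ true

  module _ {C : Pred (Fin n) 0ℓ} {v : Fin n} (exits : ExitsOnlyVia C v) where

    leaving-visits-exit : ∀ {y} ys → Linked Adjacent (y ∷ ys) → C y → ¬ C (last⁺ y ys) → ¬ ¬ (v ∈ ys)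
    leaving-visits-exit []       _           Cy ¬C-end = λ _ → ¬C-end Cy
    leaving-visits-exit (z ∷ zs) (yz ∷ rest) Cy ¬C-end v∉ = ¬¬-excluded-middle λ
      { (yes Cz) → leaving-visits-exit zs rest Cz ¬C-end (v∉ ∘ there)
      ; (no ¬Cz) → v∉ (here (≡.sym (exits yz Cy ¬Cz)))
      }

    module _ (ad-sym : ∀ x y → ad x y ≡ ad y x) where

      ¬visit-between-ends : ∀ {x} xs → Linked Adjacent (x ∷ xs) → Unique (x ∷ xs) →
                            ¬ C x → Any C xs → ¬ C (last⁺ x xs) → ⊥
      ¬visit-between-ends (y ∷ ys) (xy ∷ rest) (x∉ ∷ unique) ¬Cx visit ¬C-end =
        ¬¬-excluded-middle λ
        { (yes Cy) → leaving-visits-exit ys rest Cy ¬C-end λ v∈ys →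
                       All.lookup x∉ (there v∈ys) (exits (trans (ad-sym _ _) xy) Cy ¬Cx)
        ; (no ¬Cy) → ¬visit-between-ends ys rest unique ¬Cy (Any.tail ¬Cy visit) ¬C-end
        }

      visit-at-end : ∀ {x} xs → Linked Adjacent (x ∷ xs) → Unique (x ∷ xs) →
                     Any C (x ∷ xs) → ¬ ¬ (C x ⊎ C (last⁺ x xs))
      visit-at-end xs linked unique visit ¬end =
        ¬visit-between-ends xs linked unique (¬end ∘ inj₁) (Any.tail (¬end ∘ inj₁) visit) (¬end ∘ inj₂)

  ¬HamPath-three-pendants : (∀ x y → ad x y ≡ ad y x) → ∀ {C₁ C₂ C₃ v₁ v₂ v₃} →
    ExitsOnlyVia C₁ v₁ → ExitsOnlyVia C₂ v₂ → ExitsOnlyVia C₃ v₃ →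
    ¬ ¬ Satisfiable C₁ → ¬ ¬ Satisfiable C₂ → ¬ ¬ Satisfiable C₃ →
    Empty (C₁ ∩ C₂) → Empty (C₁ ∩ C₃) → Empty (C₂ ∩ C₃) → ¬ HamPath ad
  ¬HamPath-three-pendants ad-sym {C₁} {C₂} {C₃} exits₁ exits₂ exits₃ inh₁ inh₂ inh₃
                          disjoint₁₂ disjoint₁₃ disjoint₂₃ ham
    with HamPath.path ham | HamPath.covers ham | HamPath.linked ham | HamPath.unique ham
  ... | []     | covers | _      | _      = inh₁ λ (z , _) → case covers z of λ ()
  ... | x ∷ xs | covers | linked | unique =
    at-end exits₁ inh₁ λ end₁ → at-end exits₂ inh₂ λ end₂ → at-end exits₃ inh₃ λ end₃ →
    pigeonhole end₁ end₂ end₃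
    where
    at-end : ∀ {C v} → ExitsOnlyVia C v → ¬ ¬ Satisfiable C → ¬ ¬ (C x ⊎ C (last⁺ x xs))
    at-end exits inh ¬end =
      inh λ (z , Cz) → visit-at-end exits ad-sym xs linked unique (lose (covers z) Cz) ¬end

    pigeonhole : C₁ x ⊎ C₁ (last⁺ x xs) → C₂ x ⊎ C₂ (last⁺ x xs) → C₃ x ⊎ C₃ (last⁺ x xs) → ⊥
    pigeonhole (inj₁ c₁) (inj₁ c₂) _         = disjoint₁₂ _ (c₁ , c₂)
    pigeonhole (inj₂ c₁) (inj₂ c₂) _         = disjoint₁₂ _ (c₁ , c₂)
    pigeonhole (inj₁ c₁) _         (inj₁ c₃) = disjoint₁₃ _ (c₁ , c₃)
    pigeonhole (inj₂ c₁) _         (inj₂ c₃) = disjoint₁₃ _ (c₁ , c₃)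
    pigeonhole _         (inj₁ c₂) (inj₁ c₃) = disjoint₂₃ _ (c₂ , c₃)
    pigeonhole _         (inj₂ c₂) (inj₂ c₃) = disjoint₂₃ _ (c₂ , c₃)

EdgeRespects : ∀ {n} → Pred (Fin n) 0ℓ → Fin n → Fin n → Fin n → Set
EdgeRespects C v u w = (C u → ¬ C w → w ≡ v) × (C w → ¬ C u → u ≡ v)

respects-outside : ∀ {n} {C : Pred (Fin n) 0ℓ} {v u w} → ¬ C u → ¬ C w → EdgeRespects C v u w
respects-outside ¬Cu ¬Cw = (λ Cu _ → contradiction Cu ¬Cu) , (λ Cw _ → contradiction Cw ¬Cw)

ExitsOnlyVia-addEdge : ∀ {n} {ad : Fin n → Fin n → Bool} {C v u w} →
  ExitsOnlyVia ad C v → EdgeRespects C v u w → ExitsOnlyVia (addEdge ad u w) C v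
ExitsOnlyVia-addEdge {ad = ad} exits (uw , wu) e Cx ¬Cy with addEdge-true⁻ {a = ad} e
... | inj₁ xy                  = exits xy Cx ¬Cy
... | inj₂ (inj₁ (refl , refl)) = uw Cx ¬Cy
... | inj₂ (inj₂ (refl , refl)) = wu Cx ¬Cy

module Subgraphs {n : ℕ} (G : Graph n) where

  ReachIn : Subgraph G → Fin n → Fin n → Set
  ReachIn H = Reach (V H) (E H)

  ReachAvoiding : Subgraph G → Fin n → Fin n → Fin n → Set
  ReachAvoiding H v = Reach (delV (V H) v) (delE (E H) v)

  E-sym-true : (H : Subgraph G) → ∀ x y → E H x y ≡ true → E H y x ≡ true
  E-sym-true H x y Exy = trans (E-sym H y x) Exy

  E-V-target : (H : Subgraph G) → ∀ x y → E H x y ≡ true → V H y ≡ true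
  E-V-target H x y Exy = E-V H y x (E-sym-true H x y Exy)

  ReachIn-sym : (H : Subgraph G) → ∀ {x y} → ReachIn H x y → ReachIn H y x
  ReachIn-sym H = Reach-sym (E-sym-true H) (E-V H)

  ReachAvoiding-sym : (H : Subgraph G) → ∀ {v x y} → ReachAvoiding H v x y → ReachAvoiding H v y x
  ReachAvoiding-sym H = Reach-sym del-sym del-V
    where
    del-sym : ∀ x y → delE (E H) _ x y ≡ true → delE (E H) _ y x ≡ true
    del-sym x y p =
      let Exy , x≢v , y≢v = delE-true⁻ (E H) p in delE-true⁺ (E H) (E-sym-true H x y Exy) y≢v x≢v
    del-V : ∀ x y → delE (E H) _ x y ≡ true → delV (V H) _ x ≡ true
    del-V x y p = let Exy , x≢v , _ = delE-true⁻ (E H) p in delV-true⁺ (V H) (E-V H x y Exy) x≢v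

  ReachAvoiding-source : ∀ {H : Subgraph G} {v x y} → ReachAvoiding H v x y → x ≢ v
  ReachAvoiding-source {H} (here p)   = proj₂ (delV-true⁻ (V H) p)
  ReachAvoiding-source {H} (step e _) = proj₁ (proj₂ (delE-true⁻ (E H) e))

  ReachIn-mono : ∀ {H K : Subgraph G} → H ⊆S K → ∀ {x y} → ReachIn H x y → ReachIn K x y
  ReachIn-mono (V⊆ , E⊆) = Reach-mono V⊆ E⊆

  ReachAvoiding-mono : ∀ {H K : Subgraph G} → H ⊆S K →
                       ∀ {v x y} → ReachAvoiding H v x y → ReachAvoiding K v x y
  ReachAvoiding-mono {H} {K} (V⊆ , E⊆) = Reach-mono
    (λ x p → let Vx , x≢v = delV-true⁻ (V H) p in delV-true⁺ (V K) (V⊆ x Vx) x≢v)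
    (λ x y p → let Exy , x≢v , y≢v = delE-true⁻ (E H) p in delE-true⁺ (E K) (E⊆ x y Exy) x≢v y≢v)

  ⊆S-whole : (H : Subgraph G) → H ⊆S whole G
  ⊆S-whole H = (λ _ _ → refl) , E-adj H

  first-hit : (S : Fin n → Bool) → ∀ {x z} → ReachIn (whole G) x z → S z ≡ true →
              ∃ λ w → S w ≡ true × (∀ u → S u ≡ true → u ≢ w → ReachAvoiding (whole G) u x w)
  first-hit S {x} x⇝z Sz with S x in Sx
  ... | true = x , Sx , λ u _ u≢x → here (not-≟-true⁺ (u≢x ∘ ≡.sym))
  first-hit S (here _)      Sz | false = contradiction Sx (≡true⇒≢false Sz)
  first-hit S (step xy y⇝z) Sz | false =
    let w , Sw , avoid = first-hit S y⇝z Sz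
    in w , Sw , λ u Su u≢w → step (delE-true⁺ (adj G) xy (λ { refl → ≡true⇒≢false Su Sx })
                                      (ReachAvoiding-source {whole G} (avoid u Su u≢w)))
                                  (avoid u Su u≢w)

  induced : (Fin n → Bool) → Subgraph G
  induced S = record
    { V     = S
    ; E     = λ x y → (S x ∧ S y) ∧ adj G x y
    ; E-sym = λ x y → cong₂ _∧_ (∧-comm (S x) (S y)) (Graph.sym G x y)
    ; E-adj = λ x y → ∧-conicalʳ (S x ∧ S y) (adj G x y)
    ; E-V   = λ x y p → ∧-conicalˡ (S x) (S y) (∧-conicalˡ (S x ∧ S y) (adj G x y) p)
    }

  induced-edge : ∀ {S x y} → S x ≡ true → S y ≡ true → adj G x y ≡ true → E (induced S) x y ≡ true
  induced-edge Sx Sy xy = ∧-true (∧-true Sx Sy) xy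

  ⊆S-induced : ∀ {S} (H : Subgraph G) → (∀ x → V H x ≡ true → S x ≡ true) → H ⊆S induced S
  ⊆S-induced H H⊆S =
    H⊆S , λ x y Exy → induced-edge (H⊆S x (E-V H x y Exy)) (H⊆S y (E-V-target H x y Exy)) (E-adj H x y Exy)

  complete-nonseparable : (H : Subgraph G) → CompleteS H → Satisfiable (λ x → V H x ≡ true) →
                          Nonseparable H
  complete-nonseparable H complete inhabited = (inhabited , connected) , no-cut
    where
    connected : ∀ x y → V H x ≡ true → V H y ≡ true → ReachIn H x y
    connected x y Vx Vy with x ≟ y
    ... | yes refl = here Vx
    ... | no x≢y   = step (complete x y Vx Vy x≢y) (here Vy)

    no-cut : ∀ v → ¬ IsCutVertex H v
    no-cut v (_ , p , q , p-v , q-v , p↛q) with p ≟ q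
    ... | yes refl = p↛q (here p-v)
    ... | no p≢q   =
      let Vp , p≢v = delV-true⁻ (V H) p-v
          Vq , q≢v = delV-true⁻ (V H) q-v
      in p↛q (step (delE-true⁺ (E H) (complete p q Vp Vq p≢q) p≢v q≢v) (here q-v))

  nonseparable-avoiding : ∀ {H : Subgraph G} → Nonseparable H → ∀ {v p q} →
    delV (V H) v p ≡ true → delV (V H) v q ≡ true → ¬ ¬ ReachAvoiding H v p q
  nonseparable-avoiding {H} ((_ , connected) , no-cut) {v} {p} {q} p-v q-v p↛q with V H v in Vv
  ... | true  = no-cut v (Vv , p , q , p-v , q-v , p↛q)
  ... | false = p↛q (Reach-mono keep-V keep-E
                      (connected p q (proj₁ (delV-true⁻ (V H) p-v)) (proj₁ (delV-true⁻ (V H) q-v))))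
    where
    ≢v : ∀ {x} → V H x ≡ true → x ≢ v
    ≢v Vx refl = ≡true⇒≢false Vx Vv
    keep-V : ∀ x → V H x ≡ true → delV (V H) v x ≡ true
    keep-V x Vx = delV-true⁺ (V H) Vx (≢v Vx)
    keep-E : ∀ x y → E H x y ≡ true → delE (E H) v x y ≡ true
    keep-E x y Exy = delE-true⁺ (E H) Exy (≢v (E-V H x y Exy)) (≢v (E-V-target H x y Exy))

  nonseparable-spanning : ∀ {H K : Subgraph G} → H ⊆S K → (∀ x → V K x ≡ true → V H x ≡ true) →
                          Nonseparable H → Nonseparable K
  nonseparable-spanning {H} {K} H⊆K VK⊆VH H-ns@(((x , Hx) , connected) , _) =
    ((x , proj₁ H⊆K x Hx) ,
     λ y z Ky Kz → ReachIn-mono {H} {K} H⊆K (connected y z (VK⊆VH y Ky) (VK⊆VH z Kz))) ,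
    λ v (_ , p , q , p-v , q-v , p↛q) →
      nonseparable-avoiding {H} H-ns (shrink {v} p-v) (shrink {v} q-v)
        (p↛q ∘ ReachAvoiding-mono {H} {K} H⊆K {v})
    where
    shrink : ∀ {v y} → delV (V K) v y ≡ true → delV (V H) v y ≡ true
    shrink p = let Ky , y≢v = delV-true⁻ (V K) p in delV-true⁺ (V H) (VK⊆VH _ Ky) y≢v

  cone-vertices : Subgraph G → Fin n → Fin n → Bool
  cone-vertices H x z = does (z ≟ x) ∨ V H z

  cone : Subgraph G → Fin n → Subgraph G
  cone H x = induced (cone-vertices H x)

  module _ {H : Subgraph G} {x : Fin n} where

    cone-apex : V (cone H x) x ≡ true
    cone-apex = ∨-trueˡ (dec-true (x ≟ x) refl)

    ⊆S-cone : H ⊆S cone H x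
    ⊆S-cone = ⊆S-induced H (λ _ → ∨-trueʳ)

    cone-nonseparable : Connected H → V H x ≡ false → (∀ z → V H z ≡ true → adj G z x ≡ true) →
                        Nonseparable (cone H x)
    cone-nonseparable ((z , Hz) , connected) Hx spoke =
      ((z , proj₁ ⊆S-cone z Hz) ,
       λ y y′ Cy Cy′ → Reach-trans (to-apex y Cy) (ReachIn-sym (cone H x) (to-apex y′ Cy′))) ,
      no-cut
      where
      cone-vertex⁻ : ∀ {y} → V (cone H x) y ≡ true → y ≡ x ⊎ V H y ≡ true
      cone-vertex⁻ p with ∨-true⁻ p
      ... | inj₁ y≟x = inj₁ (≟-true⁻ y≟x)
      ... | inj₂ Hy  = inj₂ Hy

      spoke-edge : ∀ {y} → V H y ≡ true → E (cone H x) y x ≡ true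
      spoke-edge Hy = induced-edge {cone-vertices H x} (∨-trueʳ Hy) cone-apex (spoke _ Hy)

      to-apex : ∀ y → V (cone H x) y ≡ true → ReachIn (cone H x) y x
      to-apex y p with cone-vertex⁻ p
      ... | inj₁ refl = here cone-apex
      ... | inj₂ Hy   = step (spoke-edge Hy) (here cone-apex)

      ≢x : ∀ {y} → V H y ≡ true → y ≢ x
      ≢x Hy refl = ≡true⇒≢false Hy Hx

      to-apex-avoiding : ∀ {v} → x ≢ v → ∀ y → delV (V (cone H x)) v y ≡ true →
                         ReachAvoiding (cone H x) v y x
      to-apex-avoiding x≢v y p with delV-true⁻ (V (cone H x)) p
      ... | q , y≢v with cone-vertex⁻ {y} q
      ...   | inj₁ refl = here p
      ...   | inj₂ Hy   = step (delE-true⁺ (E (cone H x)) (spoke-edge Hy) y≢v x≢v)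
                               (here (delV-true⁺ (V (cone H x)) cone-apex x≢v))

      base : ∀ {y} → delV (V (cone H x)) x y ≡ true → V H y ≡ true
      base {y} p with delV-true⁻ (V (cone H x)) p
      ... | q , y≢x with cone-vertex⁻ {y} q
      ...   | inj₁ y≡x = contradiction y≡x y≢x
      ...   | inj₂ Hy  = Hy

      no-cut : ∀ v → ¬ IsCutVertex (cone H x) v
      no-cut v (_ , p , q , p-v , q-v , p↛q) with v ≟ x
      ... | yes refl = p↛q (Reach-mono
              (λ y Hy → delV-true⁺ (V (cone H x)) (∨-trueʳ Hy) (≢x Hy))
              (λ y y′ Eyy′ → delE-true⁺ (E (cone H x)) (proj₂ ⊆S-cone y y′ Eyy′)
                               (≢x (E-V H y y′ Eyy′)) (≢x (E-V-target H y y′ Eyy′)))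
              (connected p q (base p-v) (base q-v)))
      ... | no v≢x = p↛q (Reach-trans (to-apex-avoiding x≢v p p-v)
                                      (ReachAvoiding-sym (cone H x) (to-apex-avoiding x≢v q q-v)))
        where
        x≢v : x ≢ v
        x≢v = v≢x ∘ ≡.sym

  block-induced : ∀ {B : Subgraph G} → IsBlock G B → ∀ {x y} →
                  V B x ≡ true → V B y ≡ true → adj G x y ≡ true → E B x y ≡ true
  block-induced {B} (B-ns , maximal) Bx By xy =
    proj₂ (maximal (induced (V B)) (nonseparable-spanning {B} {induced (V B)} B⊆ (λ _ p → p) B-ns) B⊆) _ _
          (induced-edge {V B} Bx By xy)
    where
    B⊆ : B ⊆S induced (V B)
    B⊆ = ⊆S-induced B (λ _ p → p)

  block-¬dominated : ∀ {B : Subgraph G} → IsBlock G B → ∀ {x} → V B x ≡ false →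
                     ¬ (∀ z → V B z ≡ true → adj G z x ≡ true)
  block-¬dominated {B} (B-ns , maximal) {x} Bx dominated = ≡true⇒≢false x∈B Bx
    where
    cone⊆B : cone B x ⊆S B
    cone⊆B = maximal (cone B x) (cone-nonseparable {B} {x} (proj₁ B-ns) Bx dominated) (⊆S-cone {B} {x})
    x∈B : V B x ≡ true
    x∈B = proj₁ cone⊆B x (cone-apex {B} {x})

  block-⊆S⇒≈S : ∀ {K H : Subgraph G} → IsBlock G K → Nonseparable H → K ⊆S H → K ≈S H
  block-⊆S⇒≈S {K} {H} (_ , maximal) H-ns K⊆H = K⊆H , maximal H H-ns K⊆H

  ≉S-by-vertex : ∀ {H K : Subgraph G} {z} → V H z ≡ true → ¬ V K z ≡ true → ¬ H ≈S K
  ≉S-by-vertex Hz ¬Kz ((H⊆K , _) , _) = ¬Kz (H⊆K _ Hz)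

module Branches {n : ℕ} {G : Graph n} (B : Subgraph G) where

  open Subgraphs G

  Branch : Fin n → Pred (Fin n) 0ℓ
  Branch v x = x ≢ v × (∀ w → V B w ≡ true → w ≢ v → ¬ ReachAvoiding (whole G) v x w)

  Star : Fin n → Pred (Fin n) 0ℓ
  Star v x = x ≡ v ⊎ Branch v x

  Respects : Fin n → Fin n → Fin n → Set
  Respects t = EdgeRespects (Branch t) t

  branch-stable : ∀ {v x} → ¬ ¬ Branch v x → Branch v x
  branch-stable ¬¬branch =
    (λ x≡v → ¬¬branch λ branch → proj₁ branch x≡v) ,
    (λ w Bw w≢v x⇝w → ¬¬branch λ branch → proj₂ branch w Bw w≢v x⇝w)

  ∈B⇒¬branch : ∀ {v x} → V B x ≡ true → ¬ Branch v x
  ∈B⇒¬branch Bx (x≢v , unreachable) = unreachable _ Bx x≢v (here (not-≟-true⁺ x≢v))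

  star-¬branch : ∀ {v x} → Star v x → ¬ Branch v x → x ≡ v
  star-¬branch (inj₁ x≡v)    _       = x≡v
  star-¬branch (inj₂ branch) ¬branch = contradiction branch ¬branch

  branch-closed : ∀ {v x y} → Branch v x → ReachAvoiding (whole G) v x y → Branch v y
  branch-closed (_ , unreachable) x⇝y =
    proj₂ (delV-true⁻ (V (whole G)) (Reach-target x⇝y)) ,
    λ w Bw w≢v y⇝w → unreachable w Bw w≢v (Reach-trans x⇝y y⇝w)

  branch-exits : ∀ {v} → ExitsOnlyVia (adj G) (Branch v) v
  branch-exits {v} {x} {y} xy vx ¬vy with y ≟ v
  ... | yes y≡v = y≡v
  ... | no y≢v  = contradiction
        (branch-closed vx (step (delE-true⁺ (adj G) xy (proj₁ vx) y≢v) (here (not-≟-true⁺ y≢v)))) ¬vy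

  branch-of-neighbour : ∀ {s t x} → V B s ≡ true → adj G x s ≡ true → Branch t x → Branch s x
  branch-of-neighbour {s} {t} Bs xs branch with t ≟ s
  ... | yes refl = branch
  ... | no t≢s   = contradiction (≡.sym (branch-exits xs branch (∈B⇒¬branch Bs))) t≢s

  branches-disjoint : Connected (whole G) → ∀ {u v} → V B u ≡ true → V B v ≡ true → u ≢ v →
                      Empty (Branch u ∩ Branch v)
  branches-disjoint (_ , connected) {u} {v} Bu Bv u≢v x (ux , vx)
    with first-hit (V B) (connected x u refl refl) Bu
  ... | w , Bw , avoid with u ≟ w
  ...   | no u≢w   = proj₂ ux w Bw (u≢w ∘ ≡.sym) (avoid u Bu u≢w)
  ...   | yes refl = proj₂ vx u Bu u≢v (avoid v Bv (u≢v ∘ ≡.sym))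

  branch-inhabited : Nonseparable B → ∀ {v} → V B v ≡ true → CutVertex G v →
                     ¬ ¬ Satisfiable (Branch v)
  branch-inhabited B-ns {v} Bv (_ , x , y , x-v , y-v , x↛y) ¬branch =
    reaches-B {x} x-v λ (w₁ , Bw₁ , w₁≢v , x⇝w₁) →
    reaches-B {y} y-v λ (w₂ , Bw₂ , w₂≢v , y⇝w₂) →
    nonseparable-avoiding {H = B} B-ns (delV-true⁺ (V B) Bw₁ w₁≢v) (delV-true⁺ (V B) Bw₂ w₂≢v)
      λ w₁⇝w₂ →
    x↛y (Reach-trans x⇝w₁ (Reach-trans (ReachAvoiding-mono {H = B} {whole G} (⊆S-whole B) w₁⇝w₂)
                                        (ReachAvoiding-sym (whole G) y⇝w₂)))
    where
    reaches-B : ∀ {x} → delV (V (whole G)) v x ≡ true →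
                ¬ ¬ (∃ λ w → V B w ≡ true × w ≢ v × ReachAvoiding (whole G) v x w)
    reaches-B {x} x-v ¬reach =
      ¬branch (x , proj₂ (delV-true⁻ (V (whole G)) x-v) ,
               λ w Bw w≢v x⇝w → ¬reach (w , Bw , w≢v , x⇝w))

  module _ (connected : Connected (whole G)) (B-ns : Nonseparable B) where

    ¬HamPath-three-cut-branches : ∀ {ad a b c} → (∀ x y → ad x y ≡ ad y x) →
      CutIn G B a → CutIn G B b → CutIn G B c → a ≢ b → a ≢ c → b ≢ c →
      ExitsOnlyVia ad (Branch a) a → ExitsOnlyVia ad (Branch b) b → ExitsOnlyVia ad (Branch c) c →
      ¬ HamPath ad
    ¬HamPath-three-cut-branches ad-sym (Ba , a-cut) (Bb , b-cut) (Bc , c-cut) a≢b a≢c b≢c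
                                exits-a exits-b exits-c =
      ¬HamPath-three-pendants _ ad-sym exits-a exits-b exits-c
        (branch-inhabited B-ns Ba a-cut) (branch-inhabited B-ns Bb b-cut)
        (branch-inhabited B-ns Bc c-cut)
        (branches-disjoint connected Ba Bb a≢b) (branches-disjoint connected Ba Bc a≢c)
        (branches-disjoint connected Bb Bc b≢c)

    three-cuts-¬traceable : MoreThanTwoCuts G B → ¬ Traceable G
    three-cuts-¬traceable (_ , _ , _ , a-in , b-in , c-in , a≢b , a≢c , b≢c) =
      ¬HamPath-three-cut-branches (Graph.sym G) a-in b-in c-in a≢b a≢c b≢c
                                  branch-exits branch-exits branch-exits

    respects-in-B : ∀ {t u w} → V B u ≡ true → V B w ≡ true → Respects t u w
    respects-in-B Bu Bw = respects-outside (∈B⇒¬branch Bu) (∈B⇒¬branch Bw)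

    respects-star : ∀ {s t u w} → V B s ≡ true → V B t ≡ true → Star s u → Star s w → Respects t u w
    respects-star {s} {t} Bs Bt su sw with t ≟ s
    ... | yes refl = (λ _ → star-¬branch sw) , (λ _ → star-¬branch su)
    ... | no t≢s   = respects-outside (outside su) (outside sw)
      where
      outside : ∀ {y} → Star s y → ¬ Branch t y
      outside (inj₁ refl) = ∈B⇒¬branch Bs
      outside (inj₂ sy) ty = branches-disjoint connected Bs Bt (t≢s ∘ ≡.sym) _ (sy , ty)

    module _ (maximal : MaximalNontraceable G) where

      adj-forced : ∀ {a b c u w} → CutIn G B a → CutIn G B b → CutIn G B c →
                   a ≢ b → a ≢ c → b ≢ c → u ≢ w →
                   Respects a u w → Respects b u w → Respects c u w → adj G u w ≡ true
      adj-forced {u = u} {w} a-in b-in c-in a≢b a≢c b≢c u≢w ra rb rc with adj G u w in uw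
      ... | true  = refl
      ... | false = ⊥-elim (¬HamPath-three-cut-branches (addEdge-sym (adj G) (Graph.sym G) u w)
                      a-in b-in c-in a≢b a≢c b≢c
                      (ExitsOnlyVia-addEdge branch-exits ra) (ExitsOnlyVia-addEdge branch-exits rb)
                      (ExitsOnlyVia-addEdge branch-exits rc)
                      (proj₂ maximal u w u≢w uw))

      at-most-three-cuts : AtMostThreeCuts G B
      at-most-three-cuts
        (a , b , c , d , (Ba , a-cut) , b-in , c-in , d-in , a≢b , a≢c , a≢d , b≢c , b≢d , c≢d) =
        branch-inhabited B-ns Ba a-cut λ (x , ax) →
          a≢b (≡.sym (branch-exits
            (adj-forced b-in c-in d-in b≢c b≢d c≢d (λ { refl → ∈B⇒¬branch Bb ax })
                        (respected b-in a≢b ax) (respected c-in a≢c ax) (respected d-in a≢d ax))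
            ax (∈B⇒¬branch Bb)))
        where
        Bb : V B b ≡ true
        Bb = proj₁ b-in
        respected : ∀ {t x} → CutIn G B t → a ≢ t → Branch a x → Respects t x b
        respected (Bt , _) a≢t ax =
          respects-outside (λ tx → branches-disjoint connected Ba Bt a≢t _ (ax , tx)) (∈B⇒¬branch Bb)

      module ThreeCuts (blk : IsBlock G B) {a b c}
                       (a-in : CutIn G B a) (b-in : CutIn G B b) (c-in : CutIn G B c)
                       (a≢b : a ≢ b) (a≢c : a ≢ c) (b≢c : b ≢ c) where

        adj-if-respects-B : ∀ {u w} → u ≢ w → (∀ {t} → V B t ≡ true → Respects t u w) →
                            adj G u w ≡ true
        adj-if-respects-B u≢w respected =
          adj-forced a-in b-in c-in a≢b a≢c b≢c u≢w (respected (proj₁ a-in)) (respected (proj₁ b-in))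
                     (respected (proj₁ c-in))

        star-clique : ∀ {s u w} → V B s ≡ true → Star s u → Star s w → u ≢ w → adj G u w ≡ true
        star-clique Bs su sw u≢w = adj-if-respects-B u≢w (λ Bt → respects-star Bs Bt su sw)

        B-complete : CompleteS B
        B-complete x y Bx By x≢y =
          block-induced {B} blk Bx By (adj-if-respects-B x≢y (λ _ → respects-in-B Bx By))

        outside-B-in-branch : ∀ {x} → V B x ≡ false → ¬ ¬ (Branch a x ⊎ Branch b x ⊎ Branch c x)
        outside-B-in-branch Bx ¬branch =
          block-¬dominated {B} blk Bx λ z Bz →
            adj-forced a-in b-in c-in a≢b a≢c b≢c (λ { refl → ≡true⇒≢false Bz Bx })
              (respects-outside (∈B⇒¬branch Bz) (¬branch ∘ inj₁))
              (respects-outside (∈B⇒¬branch Bz) (¬branch ∘ inj₂ ∘ inj₁))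
              (respects-outside (∈B⇒¬branch Bz) (¬branch ∘ inj₂ ∘ inj₂))

        neighbour-outside-B-in-branch : ∀ {s x} → V B s ≡ true → V B x ≡ false → adj G s x ≡ true →
                                        Branch s x
        neighbour-outside-B-in-branch {s} {x} Bs Bx sx =
          branch-stable (¬¬-map [ from , [ from , from ] ] (outside-B-in-branch Bx))
          where
          from : ∀ {t} → Branch t x → Branch s x
          from = branch-of-neighbour Bs (E-sym-true (whole G) s x sx)

        module Star {s} (s-in : CutIn G B s) where

          -- A Boolean description of Branch s, valid once the forced edges are known.
          inBranch : Fin n → Bool
          inBranch x = adj G s x ∧ not (V B x)

          inStar : Fin n → Bool
          inStar x = does (x ≟ s) ∨ inBranch x

          star : Subgraph G
          star = induced inStar

          Bs : V B s ≡ true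
          Bs = proj₁ s-in

          inBranch⁻ : ∀ {x} → inBranch x ≡ true → Branch s x
          inBranch⁻ p =
            neighbour-outside-B-in-branch Bs (not-true⁻ (∧-conicalʳ _ _ p)) (∧-conicalˡ _ _ p)

          inBranch⁺ : ∀ {x} → Branch s x → inBranch x ≡ true
          inBranch⁺ sx = ∧-true (star-clique Bs (inj₁ refl) (inj₂ sx) (proj₁ sx ∘ ≡.sym))
                                (not-true⁺ λ Bx → ∈B⇒¬branch Bx sx)

          inStar⁻ : ∀ {x} → inStar x ≡ true → Star s x
          inStar⁻ p = Sum.map ≟-true⁻ inBranch⁻ (∨-true⁻ p)

          inStar⁺ : ∀ {x} → Star s x → inStar x ≡ true
          inStar⁺ {x} (inj₁ refl) = ∨-trueˡ (dec-true (x ≟ x) refl)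
          inStar⁺     (inj₂ sx)   = ∨-trueʳ (inBranch⁺ sx)

          centre : V star s ≡ true
          centre = inStar⁺ (inj₁ refl)

          ∉star : ∀ {z} → V B z ≡ true → z ≢ s → ¬ V star z ≡ true
          ∉star Bz z≢s p = [ z≢s , ∈B⇒¬branch Bz ] (inStar⁻ p)

          star-complete : CompleteS star
          star-complete x y sx sy x≢y =
            induced-edge {S = inStar} sx sy (star-clique Bs (inStar⁻ sx) (inStar⁻ sy) x≢y)

          star-nonseparable : Nonseparable star
          star-nonseparable = complete-nonseparable star star-complete (s , centre)

          meets-branch⇒⊆S-star : ∀ {K} → Nonseparable K →
                                 ¬ ¬ (∃ λ z → V K z ≡ true × Branch s z) → K ⊆S star
          meets-branch⇒⊆S-star {K} K-ns meets =
            ⊆S-induced K λ y Ky → decidable-stable (inStar y Bool.≟ true) (¬¬-map inStar⁺ (in-star y Ky))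
            where
            in-star : ∀ y → V K y ≡ true → ¬ ¬ Star s y
            in-star y Ky ¬star with y ≟ s
            ... | yes y≡s = ¬star (inj₁ y≡s)
            ... | no y≢s  = meets λ (z , Kz , sz) →
              nonseparable-avoiding {H = K} K-ns (delV-true⁺ (V K) Kz (proj₁ sz)) (delV-true⁺ (V K) Ky y≢s)
                λ z⇝y → ¬star (inj₂ (branch-closed sz
                                       (ReachAvoiding-mono {H = K} {whole G} (⊆S-whole K) z⇝y)))

          star-block : IsBlock G star
          star-block = star-nonseparable , λ K K-ns star⊆K → meets-branch⇒⊆S-star {K} K-ns
            (¬¬-map (λ (z , sz) → z , proj₁ star⊆K z (inStar⁺ (inj₂ sz)) , sz)
                    (branch-inhabited B-ns Bs (proj₂ s-in)))

          MeetsBranch : Subgraph G → Set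
          MeetsBranch K = ∃ λ z → V K z ≡ true × inBranch z ≡ true

          meets-branch? : ∀ K → Dec (MeetsBranch K)
          meets-branch? K = any? λ z → (V K z Bool.≟ true) ×-dec (inBranch z Bool.≟ true)

          meets-branch⇒≈S-star : ∀ {K} → IsBlock G K → MeetsBranch K → K ≈S star
          meets-branch⇒≈S-star {K} K-blk (z , Kz , bz) =
            block-⊆S⇒≈S {K} {star} K-blk star-nonseparable
              (meets-branch⇒⊆S-star {K} (proj₁ K-blk) λ k → k (z , Kz , inBranch⁻ bz))

        module Sa = Star a-in
        module Sb = Star b-in
        module Sc = Star c-in

        block-cases : ∀ K → IsBlock G K → K ≈S B ⊎ K ≈S Sa.star ⊎ K ≈S Sb.star ⊎ K ≈S Sc.star
        block-cases K K-blk with Sa.meets-branch? K | Sb.meets-branch? K | Sc.meets-branch? K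
        ... | yes m | _     | _     = inj₂ (inj₁ (Sa.meets-branch⇒≈S-star {K} K-blk m))
        ... | no _  | yes m | _     = inj₂ (inj₂ (inj₁ (Sb.meets-branch⇒≈S-star {K} K-blk m)))
        ... | no _  | no _  | yes m = inj₂ (inj₂ (inj₂ (Sc.meets-branch⇒≈S-star {K} K-blk m)))
        ... | no ¬a | no ¬b | no ¬c = inj₁ (block-⊆S⇒≈S {K} {B} K-blk (proj₁ blk) (in-B , λ x y Kxy →
              block-induced {B} blk (in-B x (E-V K x y Kxy)) (in-B y (E-V-target K x y Kxy))
                            (E-adj K x y Kxy)))
          where
          in-B : ∀ y → V K y ≡ true → V B y ≡ true
          in-B y Ky = decidable-stable (V B y Bool.≟ true) λ ¬By → outside-B-in-branch (¬-not ¬By)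
            [ (λ ay → ¬a (y , Ky , Sa.inBranch⁺ ay))
            , [ (λ by → ¬b (y , Ky , Sb.inBranch⁺ by)) , (λ cy → ¬c (y , Ky , Sc.inBranch⁺ cy)) ] ]

        four-complete-blocks : FourCompleteBlocks G
        four-complete-blocks =
          B , Sa.star , Sb.star , Sc.star ,
          blk , Sa.star-block , Sb.star-block , Sc.star-block ,
          ≉S-by-vertex {B} {Sa.star} (proj₁ b-in) (Sa.∉star (proj₁ b-in) (a≢b ∘ ≡.sym)) ,
          ≉S-by-vertex {B} {Sb.star} (proj₁ a-in) (Sb.∉star (proj₁ a-in) a≢b) ,
          ≉S-by-vertex {B} {Sc.star} (proj₁ a-in) (Sc.∉star (proj₁ a-in) a≢c) ,
          ≉S-by-vertex {Sa.star} {Sb.star} Sa.centre (Sb.∉star (proj₁ a-in) a≢b) ,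
          ≉S-by-vertex {Sa.star} {Sc.star} Sa.centre (Sc.∉star (proj₁ a-in) a≢c) ,
          ≉S-by-vertex {Sb.star} {Sc.star} Sb.centre (Sc.∉star (proj₁ b-in) b≢c) ,
          block-cases ,
          B-complete , Sa.star-complete , Sb.star-complete , Sc.star-complete

lemma4 : ∀ {n} (G : Graph n) → Connected (whole G) →
         (B : Subgraph G) → IsBlock G B →
         (MoreThanTwoCuts G B → ¬ Traceable G) ×
         (MaximalNontraceable G → AtMostThreeCuts G B) ×
         (MaximalNontraceable G → ExactlyThreeCuts G B → FourCompleteBlocks G)
lemma4 G connected B blk =
  three-cuts-¬traceable connected B-ns ,
  at-most-three-cuts connected B-ns ,
  λ maximal (_ , _ , _ , a-in , b-in , c-in , a≢b , a≢c , b≢c , _) →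
    ThreeCuts.four-complete-blocks connected B-ns maximal blk a-in b-in c-in a≢b a≢c b≢c
  where
  open Branches B
  B-ns : Nonseparable B
  B-ns = proj₁ blk
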